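{- For $n\ge1$ let $T_n=n\sqrt[n]{n}$ and let $\sigma_n$ be the largest integer $\ell$ with $n+(\ell-1)\le T_n$. If $n\ge3$, then $2\le m=\sigma_n<n$ and the finite sequence $\sigma_{n-m},\ldots,\sigma_n$ takes exactly one or exactly two distinct values. -}

module Defs where

open import Data.Nat using (ℕ; suc; _+_; _∸_; _^_; _≤_)
open import Data.Product using (_×_)

-- For ℓ with n + ℓ - 1 ≥ 0 (always, since ℓ ∈ ℕ, n ≥ 1),
--   n + (ℓ - 1) ≤ n * n^(1/n)   ⇔   (n + ℓ - 1)^n ≤ n^n * n = n^(n+1)
-- (both sides nonnegative, x ↦ x^n strictly increasing on [0,∞)).
Admissible : ℕ → ℕ → Set
Admissible n ℓ = (n + ℓ ∸ 1) ^ n ≤ n ^ suc n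

-- s is the largest integer ℓ with n + (ℓ - 1) ≤ T n.
-- (ℓ = 1 is always admissible, so the largest is ≥ 1 and ranging over ℕ suffices.)
IsSigma : ℕ → ℕ → Set
IsSigma n s = Admissible n s × (∀ ℓ → Admissible n ℓ → ℓ ≤ s)

-- Write Fits n j for n + j ≤ T n.  Taking n-th powers, this says (n + j)^n ≤ n^(n+1), i.e.
-- (1 + j/n)^n ≤ n, and σ n is 1 + max {j | Fits n j}.
-- By Bernoulli's inequality and its reversed form, (1 + x/k)^k increases with k.  At k = j this
-- gives 2^j ≤ n whenever Fits n j, hence σ n < n.  A second Bernoulli estimate shows that
-- Fits k j implies Fits (k + 1) j once j² ≤ k + 2j, which 2^j ≤ k guarantees: σ is
-- non-decreasing.  Conversely, if Fits n (i + 1) then (1 + i/n)^n ≤ n(n + i)/(2n + i) by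
-- Bernoulli, and this is at most k = n − i − 2 once k ≥ 2i + 3, so Fits k i; the finitely many
-- smaller cases are settled by evaluation.  Hence σ k ∈ {σ n − 1, σ n} for n − σ n ≤ k ≤ n.

module Submission where

open import Defs
open import Data.Fin using (Fin; toℕ; fromℕ<)
open import Data.Fin.Properties using (all?; toℕ-fromℕ<)
open import Data.List using (_∷_; [])
open import Data.Nat
open import Data.Nat.Properties
open import Algebra.Properties.CommutativeSemigroup *-commutativeSemigroup
  using (interchange; x∙yz≈y∙xz; x∙yz≈yx∙z; x∙yz≈zy∙x; xy∙z≈y∙xz; xy∙z≈x∙zy; xy∙z≈xz∙y; xy∙z≈zx∙y; xy∙z≈zy∙x)
open import Data.Nat.Tactic.RingSolver using (solve)
open import Data.Product using (_×_; ∃-syntax; _,_)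
open import Data.Sum using (_⊎_; inj₁; inj₂)
open import Function using (id; _∘_)
open import Relation.Nullary using (Dec; ¬?; contradiction)
open import Relation.Nullary.Decidable using (True; toWitness; from-yes)
open import Relation.Binary.PropositionalEquality
open ≤-Reasoning

≤-upward : (P : ℕ → Set) → (∀ m → P m → P (suc m)) → ∀ {k n} → k ≤ n → P k → P n
≤-upward P step k≤n = go (≤⇒≤′ k≤n)
  where
  go : ∀ {k n} → k ≤′ n → P k → P n
  go ≤′-refl           = id
  go (≤′-step {n} k≤n) = step n ∘ go k≤n

n^n≢0 : ∀ n → NonZero (n ^ n)
n^n≢0 zero    = _
n^n≢0 (suc n) = m^n≢0 (suc n) (suc n)

^-distribʳ-* : ∀ m n o → (m * n) ^ o ≡ m ^ o * n ^ o
^-distribʳ-* m n zero    = refl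
^-distribʳ-* m n (suc o) = begin-equality
  m * n * (m * n) ^ o        ≡⟨ cong (m * n *_) (^-distribʳ-* m n o) ⟩
  m * n * (m ^ o * n ^ o)    ≡⟨ interchange m n (m ^ o) (n ^ o) ⟩
  m * m ^ o * (n * n ^ o)    ∎

bernoulli : ∀ a b n → a ^ n * (a + suc n * b) ≤ (a + b) ^ suc n
bernoulli a b zero    = ≤-reflexive base
  where
  base : 1 * (a + 1 * b) ≡ (a + b) * 1
  base = solve (a ∷ b ∷ [])
bernoulli a b (suc n) = begin
  a * a ^ n * (a + suc (suc n) * b)                      ≡⟨ xy∙z≈y∙xz a (a ^ n) _ ⟩
  a ^ n * (a * (a + suc (suc n) * b))                    ≤⟨ *-monoʳ-≤ (a ^ n) (m≤m+n _ (suc n * (b * b))) ⟩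
  a ^ n * (a * (a + suc (suc n) * b) + suc n * (b * b))  ≡⟨ cong (a ^ n *_) (solve (a ∷ b ∷ n ∷ [])) ⟩
  a ^ n * ((a + b) * (a + suc n * b))                    ≡⟨ x∙yz≈y∙xz (a ^ n) (a + b) _ ⟩
  (a + b) * (a ^ n * (a + suc n * b))                    ≤⟨ *-monoʳ-≤ (a + b) (bernoulli a b n) ⟩
  (a + b) * (a + b) ^ suc n                              ∎

bernoulli′ : ∀ a b n → a ^ n * (a + n * b) ≤ a * (a + b) ^ n
bernoulli′ a b zero    = ≤-reflexive base
  where
  base : 1 * (a + 0 * b) ≡ a * 1
  base = solve (a ∷ b ∷ [])
bernoulli′ a b (suc n) = begin
  a * a ^ n * (a + suc n * b)    ≡⟨ *-assoc a (a ^ n) _ ⟩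
  a * (a ^ n * (a + suc n * b))  ≤⟨ *-monoʳ-≤ a (bernoulli a b n) ⟩
  a * (a + b) ^ suc n            ∎

bernoulli⁻ : ∀ a b n → (a + b) ^ suc n ≤ a ^ suc n + suc n * b * (a + b) ^ n
bernoulli⁻ a b zero    = ≤-reflexive base
  where
  base : (a + b) * 1 ≡ a * 1 + 1 * b * 1
  base = solve (a ∷ b ∷ [])
bernoulli⁻ a b (suc n) = begin
  (a + b) * (a + b) ^ suc n              ≤⟨ *-monoʳ-≤ (a + b) (bernoulli⁻ a b n) ⟩
  (a + b) * (A + suc n * b * (a + b) ^ n) ≡⟨ expand A ((a + b) ^ n) ⟩
  a * A + b * A + suc n * b * C          ≤⟨ +-monoˡ-≤ _ (+-monoʳ-≤ (a * A) (*-monoʳ-≤ b A≤C)) ⟩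
  a * A + b * C + suc n * b * C          ≡⟨ collect A C ⟩
  a * A + suc (suc n) * b * C            ∎
  where
  A C : ℕ
  A = a ^ suc n
  C = (a + b) ^ suc n
  A≤C : A ≤ C
  A≤C = ^-monoˡ-≤ (suc n) (m≤m+n a b)
  expand : ∀ p q → (a + b) * (p + suc n * b * q) ≡ a * p + b * p + suc n * b * ((a + b) * q)
  expand p q = solve (a ∷ b ∷ n ∷ p ∷ q ∷ [])
  collect : ∀ p q → a * p + b * q + suc n * b * q ≡ a * p + suc (suc n) * b * q
  collect p q = solve (a ∷ b ∷ n ∷ p ∷ q ∷ [])

[1+x/k]^k-step : ∀ x k → (k + x) ^ k * suc k ^ suc k ≤ (suc k + x) ^ suc k * k ^ k
[1+x/k]^k-step x zero       = s≤s z≤n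
[1+x/k]^k-step x k@(suc k′) = *-cancelˡ-≤ k (begin
  k * ((k + x) ^ k * suc k ^ suc k)        ≡⟨ shuffle ((k + x) ^ k) (suc k ^ k) ⟩
  suc k * k * (suc k ^ k * (k + x) ^ k)    ≡⟨ cong (suc k * k *_) (sym (^-distribʳ-* (suc k) (k + x) k)) ⟩
  suc k * k * (suc k * (k + x)) ^ k        ≡⟨ cong (λ y → suc k * k * y ^ k) (sym e+x≡) ⟩
  suc k * k * (e + x) ^ k                  ≤⟨ +-cancelʳ-≤ (suc k * x * (e + x) ^ k) _ _ drop-x ⟩
  e ^ suc k                                ≡⟨ ^-distribʳ-* k (suc k + x) (suc k) ⟩
  k * k ^ k * (suc k + x) ^ suc k          ≡⟨ xy∙z≈x∙zy k (k ^ k) _ ⟩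
  k * ((suc k + x) ^ suc k * k ^ k)        ∎)
  where
  e : ℕ
  e = k * (suc k + x)
  e+x≡ : k * (suc k + x) + x ≡ suc k * (k + x)
  e+x≡ = solve (k′ ∷ x ∷ [])
  shuffle : ∀ p q → k * (p * (suc k * q)) ≡ suc k * k * (q * p)
  shuffle p q = solve (k′ ∷ p ∷ q ∷ [])
  split : ∀ y → suc k * k * y + suc k * x * y ≡ suc k * (k + x) * y
  split y = solve (k′ ∷ x ∷ y ∷ [])
  drop-x : suc k * k * (e + x) ^ k + suc k * x * (e + x) ^ k ≤ e ^ suc k + suc k * x * (e + x) ^ k
  drop-x = begin
    suc k * k * (e + x) ^ k + suc k * x * (e + x) ^ k  ≡⟨ split ((e + x) ^ k) ⟩
    suc k * (k + x) * (e + x) ^ k                       ≡⟨ cong (_* (e + x) ^ k) (sym e+x≡) ⟩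
    (e + x) ^ suc k                                     ≤⟨ bernoulli⁻ e x k ⟩
    e ^ suc k + suc k * x * (e + x) ^ k                 ∎

[1+x/k]^k-mono : ∀ x {k n} → k ≤ n → (k + x) ^ k * n ^ n ≤ (n + x) ^ n * k ^ k
[1+x/k]^k-mono x {k} k≤n = ≤-upward (λ n → (k + x) ^ k * n ^ n ≤ (n + x) ^ n * k ^ k) step k≤n ≤-refl
  where
  step : ∀ n → (k + x) ^ k * n ^ n ≤ (n + x) ^ n * k ^ k →
         (k + x) ^ k * suc n ^ suc n ≤ (suc n + x) ^ suc n * k ^ k
  step n ih = *-cancelʳ-≤ (a * f) (e * b) d {{n^n≢0 n}} (begin
    a * f * d  ≡⟨ xy∙z≈xz∙y a f d ⟩
    a * d * f  ≤⟨ *-monoˡ-≤ f ih ⟩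
    c * b * f  ≡⟨ xy∙z≈xz∙y c b f ⟩
    c * f * b  ≤⟨ *-monoˡ-≤ b ([1+x/k]^k-step x n) ⟩
    e * d * b  ≡⟨ xy∙z≈xz∙y e d b ⟩
    e * b * d  ∎)
    where
    a b c d e f : ℕ
    a = (k + x) ^ k
    b = k ^ k
    c = (n + x) ^ n
    d = n ^ n
    e = (suc n + x) ^ suc n
    f = suc n ^ suc n

n<2^n : ∀ n → n < 2 ^ n
n<2^n zero    = s≤s z≤n
n<2^n (suc n) = begin-strict
  suc n               ≡⟨ +-comm 1 n ⟩
  n + 1               <⟨ +-mono-<-≤ (n<2^n n) (m^n>0 2 n) ⟩
  2 ^ n + 2 ^ n       ≡⟨ cong (2 ^ n +_) (sym (+-identityʳ (2 ^ n))) ⟩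
  2 ^ suc n           ∎

2*n≤2^n : ∀ n → 2 * n ≤ 2 ^ n
2*n≤2^n zero    = z≤n
2*n≤2^n (suc n) = *-monoʳ-≤ 2 (n<2^n n)

n*n≤2^n+2*n : ∀ n → n * n ≤ 2 ^ n + 2 * n
n*n≤2^n+2*n zero    = z≤n
n*n≤2^n+2*n (suc n) = begin
  suc n * suc n                    ≡⟨ solve (n ∷ []) ⟩
  n * n + 2 * n + 1                ≤⟨ +-monoˡ-≤ 1 (+-mono-≤ (n*n≤2^n+2*n n) (2*n≤2^n n)) ⟩
  2 ^ n + 2 * n + 2 ^ n + 1        ≤⟨ +-monoʳ-≤ (2 ^ n + 2 * n + 2 ^ n) (n≤1+n 1) ⟩
  2 ^ n + 2 * n + 2 ^ n + 2        ≡⟨ regroup (2 ^ n) ⟩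
  2 * 2 ^ n + 2 * suc n            ∎
  where
  regroup : ∀ p → p + 2 * n + p + 2 ≡ 2 * p + 2 * suc n
  regroup p = solve (n ∷ p ∷ [])

3[4+i]+2≤2^[4+i] : ∀ i → 3 * (4 + i) + 2 ≤ 2 ^ (4 + i)
3[4+i]+2≤2^[4+i] zero    = m≤m+n 14 2
3[4+i]+2≤2^[4+i] (suc i) = begin
  3 * (5 + i) + 2                    ≡⟨ solve (i ∷ []) ⟩
  3 + (3 * (4 + i) + 2)              ≤⟨ +-mono-≤ (≤-trans (s≤s (s≤s (s≤s z≤n))) ih) ih ⟩
  2 ^ (4 + i) + 2 ^ (4 + i)          ≡⟨ cong (2 ^ (4 + i) +_) (sym (+-identityʳ _)) ⟩
  2 ^ (5 + i)                        ∎
  where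
  ih : 3 * (4 + i) + 2 ≤ 2 ^ (4 + i)
  ih = 3[4+i]+2≤2^[4+i] i

-- Fits n j is Admissible n (1 + j) with the truncated subtraction removed.
Fits : ℕ → ℕ → Set
Fits n j = (n + j) ^ n ≤ n ^ suc n

fits? : ∀ n j → Dec (Fits n j)
fits? n j = (n + j) ^ n ≤? n ^ suc n

fits⇒≥ : ∀ m j {n} {_ : True (all? λ (l : Fin m) → ¬? (fits? (toℕ l) j))} → Fits n j → m ≤ n
fits⇒≥ m j {n} {none-below} fits = ≮⇒≥ λ n<m →
  toWitness none-below (fromℕ< n<m) (subst (λ l → Fits l j) (sym (toℕ-fromℕ< n<m)) fits)

fits-zero : ∀ {n} → 1 ≤ n → Fits n 0
fits-zero {n} 1≤n = subst (λ m → m ^ n ≤ n ^ suc n) (sym (+-identityʳ n)) (m≤n*m (n ^ n) n {{>-nonZero 1≤n}})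

fits-antitone : ∀ {n i j} → i ≤ j → Fits n j → Fits n i
fits-antitone {n} i≤j = ≤-trans (^-monoˡ-≤ n (+-monoʳ-≤ n i≤j))

fits⇒2^j≤n′ : ∀ {n j} → j ≤ n → Fits n j → 2 ^ j ≤ n
fits⇒2^j≤n′ {n} {j} j≤n fits = *-cancelˡ-≤ (j ^ j * n ^ n) {{m*n≢0 _ _ {{n^n≢0 j}} {{n^n≢0 n}}}} (begin
  j ^ j * n ^ n * 2 ^ j    ≡⟨ xy∙z≈zx∙y (j ^ j) (n ^ n) (2 ^ j) ⟩
  2 ^ j * j ^ j * n ^ n    ≡⟨ cong (_* n ^ n) (sym (^-distribʳ-* 2 j j)) ⟩
  (2 * j) ^ j * n ^ n      ≡⟨ cong (λ m → m ^ j * n ^ n) (solve (j ∷ [])) ⟩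
  (j + j) ^ j * n ^ n      ≤⟨ [1+x/k]^k-mono j j≤n ⟩
  (n + j) ^ n * j ^ j      ≤⟨ *-monoˡ-≤ (j ^ j) fits ⟩
  n * n ^ n * j ^ j        ≡⟨ xy∙z≈zy∙x n (n ^ n) (j ^ j) ⟩
  j ^ j * n ^ n * n        ∎)

fits⇒2^j≤n : ∀ {n j} → Fits n j → 2 ^ j ≤ n
fits⇒2^j≤n {n} {j} fits with ≤-total j n
... | inj₁ j≤n = fits⇒2^j≤n′ j≤n fits
... | inj₂ n≤j = contradiction (fits⇒2^j≤n′ ≤-refl (fits-antitone {n} n≤j fits)) (<⇒≱ (n<2^n n))

fits-suc : ∀ {k j} → j * j ≤ k + 2 * j → Fits k j → Fits (suc k) j
fits-suc {zero}          _   ()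
fits-suc {k@(suc k′)} {j} j²≤ fits = *-cancelˡ-≤ W {{m*n≢0 _ _ {{m^n≢0 k (suc k)}}}} (begin
  W * (suc k + j) ^ suc k                                  ≡⟨ xy∙z≈xz∙y (k ^ suc k) M ((suc k + j) ^ suc k) ⟩
  k ^ suc k * (suc k + j) ^ suc k * (suc k * (k + 2 * j))  ≡⟨ cong₂ _*_ (sym (^-distribʳ-* k (suc k + j) (suc k))) (sym e+[2+k]j≡) ⟩
  e ^ suc k * (e + suc (suc k) * j)                        ≤⟨ bernoulli e j (suc k) ⟩
  (e + j) ^ suc (suc k)                                    ≡⟨ cong (_^ suc (suc k)) e+j≡ ⟩
  (suc k * (k + j)) ^ suc (suc k)                          ≡⟨ ^-distribʳ-* (suc k) (k + j) (suc (suc k)) ⟩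
  suc k ^ suc (suc k) * ((k + j) * ((k + j) * (k + j) ^ k)) ≡⟨ cong (suc k ^ suc (suc k) *_) (sym (*-assoc (k + j) (k + j) _)) ⟩
  suc k ^ suc (suc k) * ((k + j) * (k + j) * (k + j) ^ k)  ≤⟨ *-monoʳ-≤ (suc k ^ suc (suc k)) (*-mono-≤ square fits) ⟩
  suc k ^ suc (suc k) * (suc k * (k + 2 * j) * k ^ suc k)  ≡⟨ x∙yz≈zy∙x (suc k ^ suc (suc k)) M (k ^ suc k) ⟩
  W * suc k ^ suc (suc k)                                  ∎)
  where
  e M W : ℕ
  e = k * (suc k + j)
  M = suc k * (k + 2 * j)
  W = k ^ suc k * M
  e+j≡ : k * (suc k + j) + j ≡ suc k * (k + j)
  e+j≡ = solve (k′ ∷ j ∷ [])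
  e+[2+k]j≡ : k * (suc k + j) + suc (suc k) * j ≡ suc k * (k + 2 * j)
  e+[2+k]j≡ = solve (k′ ∷ j ∷ [])
  square : (k + j) * (k + j) ≤ suc k * (k + 2 * j)
  square = begin
    (k + j) * (k + j)                ≡⟨ solve (k′ ∷ j ∷ []) ⟩
    k * k + 2 * k * j + j * j        ≤⟨ +-monoʳ-≤ (k * k + 2 * k * j) j²≤ ⟩
    k * k + 2 * k * j + (k + 2 * j)  ≡⟨ solve (k′ ∷ j ∷ []) ⟩
    suc k * (k + 2 * j)              ∎

fits-mono : ∀ {k n j} → k ≤ n → Fits k j → Fits n j
fits-mono {j = j} = ≤-upward (λ m → Fits m j) λ m fits →
  fits-suc {m} (≤-trans (n*n≤2^n+2*n j) (+-monoˡ-≤ (2 * j) (fits⇒2^j≤n {m} fits))) fits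

fits-one : ∀ {n} → 3 ≤ n → Fits n 1
fits-one 3≤n = fits-mono 3≤n (from-yes (fits? 3 1))

fits-step-back : ∀ {k} i → 3 + 2 * i ≤ k → Fits (k + (2 + i)) (suc i) → Fits k i
fits-step-back {zero}       i ()
fits-step-back {k@(suc k′)} i room fits = *-cancelʳ-≤ ((k + i) ^ k) (k ^ suc k) G (begin
  (k + i) ^ k * G          ≤⟨ *-cancelˡ-≤ (n ^ n) {{n^n≢0 n}} compare-at-n ⟩
  k ^ k * (n * (n + i))    ≤⟨ *-monoʳ-≤ (k ^ k) quadratic ⟩
  k ^ k * (k * G)          ≡⟨ x∙yz≈yx∙z (k ^ k) k G ⟩
  k ^ suc k * G            ∎)
  where
  n G : ℕ
  n = k + (2 + i)
  G = n + i + n * 1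
  fits′ : (n + i + 1) ^ n ≤ n ^ suc n
  fits′ = subst (λ m → m ^ n ≤ n ^ suc n) (trans (+-suc n i) (+-comm 1 (n + i))) fits
  compare-at-n : n ^ n * ((k + i) ^ k * G) ≤ n ^ n * (k ^ k * (n * (n + i)))
  compare-at-n = begin
    n ^ n * ((k + i) ^ k * G)            ≡⟨ x∙yz≈yx∙z (n ^ n) ((k + i) ^ k) G ⟩
    (k + i) ^ k * n ^ n * G              ≤⟨ *-monoˡ-≤ G ([1+x/k]^k-mono i (m≤m+n k (2 + i))) ⟩
    (n + i) ^ n * k ^ k * G              ≡⟨ xy∙z≈y∙xz ((n + i) ^ n) (k ^ k) G ⟩
    k ^ k * ((n + i) ^ n * G)            ≤⟨ *-monoʳ-≤ (k ^ k) (bernoulli′ (n + i) 1 n) ⟩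
    k ^ k * ((n + i) * (n + i + 1) ^ n)  ≤⟨ *-monoʳ-≤ (k ^ k) (*-monoʳ-≤ (n + i) fits′) ⟩
    k ^ k * ((n + i) * (n * n ^ n))      ≡⟨ shuffle (k ^ k) (n ^ n) (n + i) n ⟩
    n ^ n * (k ^ k * (n * (n + i)))      ∎
    where
    shuffle : ∀ p q r s → p * (r * (s * q)) ≡ q * (p * (s * r))
    shuffle p q r s = solve (p ∷ q ∷ r ∷ s ∷ [])
  quadratic : n * (n + i) ≤ k * G
  quadratic = begin
    (k + (2 + i)) * (k + (2 + i) + i)                          ≡⟨ solve (k′ ∷ i ∷ []) ⟩
    k * k + (4 + 3 * i) * k + (2 * (i * i) + 6 * i + 4)        ≤⟨ +-monoʳ-≤ (k * k + (4 + 3 * i) * k) small ⟩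
    k * k + (4 + 3 * i) * k + k * k                            ≡⟨ solve (k′ ∷ i ∷ []) ⟩
    k * (k + (2 + i) + i + (k + (2 + i)) * 1)                  ∎
    where
    small : 2 * (i * i) + 6 * i + 4 ≤ k * k
    small = begin
      2 * (i * i) + 6 * i + 4                                  ≤⟨ m≤m+n _ (2 * (i * i) + 6 * i + 5) ⟩
      2 * (i * i) + 6 * i + 4 + (2 * (i * i) + 6 * i + 5)      ≡⟨ solve (i ∷ []) ⟩
      (3 + 2 * i) * (3 + 2 * i)                                ≤⟨ *-mono-≤ room room ⟩
      k * k                                                    ∎

fits⇒3j+2≤n : ∀ {n} i → Fits n (3 + i) → 3 * (3 + i) + 2 ≤ n
fits⇒3j+2≤n zero    fits = fits⇒≥ 11 3 fits
fits⇒3j+2≤n (suc i) fits = ≤-trans (3[4+i]+2≤2^[4+i] i) (fits⇒2^j≤n fits)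

fits-lower : ∀ {n k} i → Fits n (suc i) → n ∸ (2 + i) ≤ k → 1 ≤ k → Fits k i
fits-lower zero _ _ 1≤k = fits-zero 1≤k
-- For i = 1, n can be 6, too small for fits-step-back.
fits-lower {n} (suc zero) fits lo _ = fits-one (≤-trans (∸-monoˡ-≤ 3 (fits⇒≥ 6 2 {n} fits)) lo)
fits-lower {n} (suc (suc i)) fits lo _ = fits-mono lo (fits-step-back (2 + i) room fits′)
  where
  n-large : (3 + 2 * (2 + i)) + (4 + i) ≤ n
  n-large = subst (_≤ n) split (fits⇒3j+2≤n i fits)
    where
    split : 3 * (3 + i) + 2 ≡ (3 + 2 * (2 + i)) + (4 + i)
    split = solve (i ∷ [])
  room : 3 + 2 * (2 + i) ≤ n ∸ (4 + i)
  room = subst (_≤ n ∸ (4 + i)) (m+n∸n≡m _ (4 + i)) (∸-monoˡ-≤ (4 + i) n-large)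
  fits′ : Fits (n ∸ (4 + i) + (4 + i)) (3 + i)
  fits′ = subst (λ m → Fits m (3 + i))
                (sym (m∸n+n≡m (≤-trans (m≤n+m (4 + i) (3 + 2 * (2 + i))) n-large))) fits

fits⇒2+j≤n : ∀ {n j} → 3 ≤ n → Fits n j → 2 + j ≤ n
fits⇒2+j≤n {j = zero}           3≤n _    = ≤-trans (n≤1+n 2) 3≤n
fits⇒2+j≤n {j = suc zero}       3≤n _    = 3≤n
fits⇒2+j≤n {n} {suc (suc i)}    _   fits = begin
  2 + (2 + i)           ≤⟨ +-monoˡ-≤ (2 + i) (s≤s (s≤s z≤n)) ⟩
  (2 + i) + (2 + i)     ≡⟨ cong ((2 + i) +_) (sym (+-identityʳ (2 + i))) ⟩
  2 * (2 + i)           ≤⟨ 2*n≤2^n (2 + i) ⟩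
  2 ^ (2 + i)           ≤⟨ fits⇒2^j≤n {n} fits ⟩
  n                     ∎

sigma-fits : ∀ n {j} → IsSigma n (suc j) → Fits n j
sigma-fits n {j} (admissible , _) = subst (λ m → (m ∸ 1) ^ n ≤ n ^ suc n) (+-suc n j) admissible

fits⇒<sigma : ∀ n {s j} → IsSigma n s → Fits n j → j < s
fits⇒<sigma n {j = j} (_ , maximal) fits =
  maximal (suc j) (subst (λ m → (m ∸ 1) ^ n ≤ n ^ suc n) (sym (+-suc n j)) fits)

sigma⇒1≤n : ∀ n {s} → IsSigma n s → 1 ≤ n
sigma⇒1≤n zero    (() , _)
sigma⇒1≤n (suc n) _ = s≤s z≤n

sigma-mono : ∀ {k n s t} → k ≤ n → IsSigma k s → IsSigma n t → s ≤ t
sigma-mono {s = zero}      _   _  _  = z≤n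
sigma-mono {k} {n} {suc j} k≤n σk σn = fits⇒<sigma n σn (fits-mono k≤n (sigma-fits k σk))

sigma-≥pred : ∀ n k {s t} → IsSigma n s → IsSigma k t → n ∸ s ≤ k → pred s ≤ t
sigma-≥pred n k {zero}        _  _  _  = z≤n
sigma-≥pred n k {suc zero}    _  _  _  = z≤n
sigma-≥pred n k {suc (suc i)} σn σk lo =
  fits⇒<sigma k σk (fits-lower {n} {k} i (sigma-fits n σn) lo (sigma⇒1≤n k σk))

sigma-≥2 : ∀ {n s} → 3 ≤ n → IsSigma n s → 2 ≤ s
sigma-≥2 {n} 3≤n σn = fits⇒<sigma n σn (fits-one 3≤n)

sigma-< : ∀ {n s} → 3 ≤ n → IsSigma n s → s < n
sigma-< {s = zero} 3≤n _  = ≤-trans (s≤s z≤n) 3≤n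
sigma-< {n} {suc j} 3≤n σn = fits⇒2+j≤n 3≤n (sigma-fits n σn)

m≡n∨m≡pred-n : ∀ {m n} → pred n ≤ m → m ≤ n → m ≡ n ⊎ m ≡ pred n
m≡n∨m≡pred-n lo hi with m≤n⇒m<n∨m≡n hi
... | inj₁ m<n = inj₂ (≤-antisym (<⇒≤pred m<n) lo)
... | inj₂ m≡n = inj₁ m≡n

corollary3 : (σ : ℕ → ℕ) → (∀ n → 1 ≤ n → IsSigma n (σ n)) →
    ∀ n → 3 ≤ n →
      (2 ≤ σ n) × (σ n < n) ×
      (∃[ a ] ∃[ b ] (∀ k → n ∸ σ n ≤ k → k ≤ n → (σ k ≡ a ⊎ σ k ≡ b)))
corollary3 σ isSigma n 3≤n = sigma-≥2 3≤n σn , σn<n , σ n , pred (σ n) , between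
  where
  σn : IsSigma n (σ n)
  σn = isSigma n (≤-trans (s≤s z≤n) 3≤n)
  σn<n : σ n < n
  σn<n = sigma-< 3≤n σn
  between : ∀ k → n ∸ σ n ≤ k → k ≤ n → σ k ≡ σ n ⊎ σ k ≡ pred (σ n)
  between k lo k≤n = m≡n∨m≡pred-n (sigma-≥pred n k σn σk lo) (sigma-mono k≤n σk σn)
    where
    σk : IsSigma k (σ k)
    σk = isSigma k (≤-trans (m<n⇒0<n∸m σn<n) lo)
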